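{- For every $r\ge 1$, there exists a symmetric generating set $S$ of the free group $F_r$ with $|S|<6r$ such that the Cayley graph $\Gamma(F_r,S)$ is $2$-connected.
   Context: $F_r$ is the free group of rank $r$. $\Gamma(G,S)$ is the Cayley graph with vertex set $G$ and edges $\{g,gs\}$, $s\in S$. -}

module Defs where

open import Data.Nat using (ℕ; _<_; _*_)
open import Data.Fin as Fin using (Fin)
open import Data.Bool as Bool using (Bool; not)
open import Data.Product using (Σ; _×_; _,_; ∃; ∃-syntax)
open import Data.Product.Properties using (≡-dec)
open import Data.List using (List; []; _∷_; [_]; foldr; reverse; map; length)
open import Data.List.Membership.Propositional using (_∈_)
open import Data.List.Relation.Unary.All using (All)
open import Data.List.Relation.Unary.Unique.Propositional using (Unique)
open import Data.Unit using (⊤)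
open import Relation.Nullary using (¬_; does)
open import Relation.Binary.PropositionalEquality using (_≡_; _≢_)
open import Relation.Binary.Definitions using (DecidableEquality)

-- The free group F_r on generators a_0 … a_{r-1}, realised as
-- freely reduced words.

-- A letter (i , false) stands for a_i, (i , true) for a_i⁻¹.
Letter : ℕ → Set
Letter r = Fin r × Bool

_≟ₗ_ : ∀ {r} → DecidableEquality (Letter r)
_≟ₗ_ = ≡-dec Fin._≟_ Bool._≟_

invL : ∀ {r} → Letter r → Letter r
invL (i , b) = i , not b

Word : ℕ → Set
Word r = List (Letter r)

Reduced : ∀ {r} → Word r → Set
Reduced []            = ⊤
Reduced (x ∷ [])      = ⊤
Reduced (x ∷ y ∷ w)   = (y ≢ invL x) × Reduced (y ∷ w)

push : ∀ {r} → Letter r → Word r → Word r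
push x []      = [ x ]
push x (y ∷ w) with does (y ≟ₗ invL x)
... | Bool.true  = w
... | Bool.false = x ∷ y ∷ w

_·_ : ∀ {r} → Word r → Word r → Word r
u · v = foldr push v u

e : ∀ {r} → Word r
e = []

inv : ∀ {r} → Word r → Word r
inv w = reverse (map invL w)

prod : ∀ {r} → List (Word r) → Word r
prod = foldr _·_ e

Elem : ℕ → Set
Elem r = Σ (Word r) Reduced

-- Finite subsets of F_r, given as duplicate-free lists of elements
-- (so |S| = length of the list).

IsSubset : ∀ {r} → List (Word r) → Set
IsSubset S = All Reduced S × Unique S

Symmetric : ∀ {r} → List (Word r) → Set
Symmetric S = ∀ {s} → s ∈ S → inv s ∈ S

Generates : ∀ {r} → List (Word r) → Set
Generates {r} S = ∀ (g : Word r) → Reduced g →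
  ∃[ ss ] (All (_∈ S) ss × g ≡ prod ss)

CayleyAdj : ∀ {r} → List (Word r) → Word r → Word r → Set
CayleyAdj S g h = ∃[ s ] (s ∈ S × h ≡ g · s)

-- Walks in a graph (adjacency Adj on a type V) all of whose vertices
-- satisfy the predicate P (used for induced subgraphs).
data Walk {V : Set} (Adj : V → V → Set) (P : V → Set) : V → V → Set where
  stop : ∀ {x} → P x → Walk Adj P x x
  step : ∀ {x y z} → P x → Adj x y → Walk Adj P y z → Walk Adj P x z

ConnectedOn : {V : Set} → (V → V → Set) → (V → Set) → Set
ConnectedOn {V} Adj P =
  (∃[ x ] P x) × (∀ x y → P x → P y → Walk Adj P x y)

TwoConnectedOn : {V : Set} → (V → V → Set) → (V → Set) → Set
TwoConnectedOn {V} Adj P =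
  (∃[ a ] ∃[ b ] ∃[ c ] (P a × P b × P c × a ≢ b × a ≢ c × b ≢ c))
  × ConnectedOn Adj P
  × (∀ v → P v → ConnectedOn Adj (λ x → P x × x ≢ v))

CayleyTwoConnected : ∀ {r} → List (Word r) → Set
CayleyTwoConnected {r} S = TwoConnectedOn (CayleyAdj S) (Reduced {r})

module Submission where

-- Write a₀, …, a_{r-1} for the free generators of F_r and
-- take S = {a_i^{±1}} ∪ {a_i^{±2}} ∪ {a₀⁻¹a_i , a_i⁻¹a₀ : 1 ≤ i < r}, a
-- symmetric set of 2r + 2r + 2(r-1) = 6r - 2 reduced words.
--
-- Left multiplication by v is an automorphism of Γ(F_r , S) sending e
-- to v, so Γ - v is connected for every v as soon as Γ - e is.  To
-- connect Γ - e, join each non-trivial reduced word to its own prefix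
-- (an edge labelled by the inverse of its last letter, avoiding e), so
-- every vertex of Γ - e reaches a one-letter word; the one-letter words
-- are then joined to a₀ inside Γ - e using the squares and the mixed
-- words a_i⁻¹a₀.

open import Defs
open import Data.Nat using (ℕ; suc; _≤_; _<_; _+_; _*_)
open import Data.Nat.Properties using (n<1+n; m≤n⇒m≤1+n)
open import Data.Nat.Solver using (module +-*-Solver)
open import Data.Fin as Fin using (Fin)
open import Data.Bool using (true; false)
open import Data.Bool.Properties using (not-involutive)
open import Data.Product using (_×_; _,_; ∃-syntax; proj₁)
open import Data.Sum using (_⊎_; inj₁; inj₂)
open import Data.List using (List; []; _∷_; [_]; map; _++_; _∷ʳ_; allFin; length)
open import Data.List.Properties using (∷-injectiveˡ; foldr-++; unfold-reverse; length-++; length-map; length-tabulate)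
open import Data.List.Reverse using (Reverse; _∶_∶ʳ_; reverseView)
import Data.List.Reverse as Reverse
open import Data.List.Relation.Unary.All as All using (All)
open import Data.List.Membership.Propositional using (_∈_)
open import Data.List.Membership.Propositional.Properties using (∈-map⁺; ∈-map⁻; ∈-++⁺ˡ; ∈-++⁺ʳ; ∈-++⁻; ∈-allFin)
open import Data.List.Relation.Unary.Unique.Propositional using (Unique)
import Data.List.Relation.Unary.Unique.Propositional.Properties as Unique
open import Data.List.Relation.Binary.Disjoint.Propositional using (Disjoint)
open import Data.Empty using (⊥-elim)
open import Data.Unit using (tt)
open import Relation.Nullary using (yes; no)
open import Relation.Binary.PropositionalEquality hiding ([_])
open ≡-Reasoning

-- Free-group arithmetic on reduced words

module _ {r : ℕ} where

  invL-involutive : ∀ (x : Letter r) → invL (invL x) ≡ x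
  invL-involutive (i , b) = cong (i ,_) (not-involutive b)

  push-cases : ∀ (x y : Letter r) w →
    (y ≡ invL x × push x (y ∷ w) ≡ w) ⊎ (y ≢ invL x × push x (y ∷ w) ≡ x ∷ y ∷ w)
  push-cases x y w with y ≟ₗ invL x
  ... | yes y≡x⁻¹ = inj₁ (y≡x⁻¹ , refl)
  ... | no  y≢x⁻¹ = inj₂ (y≢x⁻¹ , refl)

  push-inverse : ∀ {x y} {w : Word r} → y ≡ invL x → push x (y ∷ w) ≡ w
  push-inverse {x} {y} {w} y≡x⁻¹ with push-cases x y w
  ... | inj₁ (_ , eq)     = eq
  ... | inj₂ (y≢x⁻¹ , _) = ⊥-elim (y≢x⁻¹ y≡x⁻¹)

  push-nonInverse : ∀ {x y} {w : Word r} → y ≢ invL x → push x (y ∷ w) ≡ x ∷ y ∷ w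
  push-nonInverse {x} {y} {w} y≢x⁻¹ with push-cases x y w
  ... | inj₁ (y≡x⁻¹ , _) = ⊥-elim (y≢x⁻¹ y≡x⁻¹)
  ... | inj₂ (_ , eq)     = eq

  letter≢invL : ∀ (x : Letter r) → x ≢ invL x
  letter≢invL (_ , false) ()
  letter≢invL (_ , true)  ()

  reduced-tail : ∀ y (w : Word r) → Reduced (y ∷ w) → Reduced w
  reduced-tail y []      _          = tt
  reduced-tail y (z ∷ w) (_ , red) = red

  push-reduced : ∀ x (w : Word r) → Reduced w → Reduced (push x w)
  push-reduced x []      _  = tt
  push-reduced x (y ∷ w) rw with push-cases x y w
  ... | inj₁ (_ , eq)     = subst Reduced (sym eq) (reduced-tail y w rw)
  ... | inj₂ (y≢x⁻¹ , eq) = subst Reduced (sym eq) (y≢x⁻¹ , rw)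

  ·-reduced : ∀ (u w : Word r) → Reduced w → Reduced (u · w)
  ·-reduced []      w rw = rw
  ·-reduced (x ∷ u) w rw = push-reduced x (u · w) (·-reduced u w rw)

  push-cancelˡ : ∀ x (w : Word r) → Reduced w → push (invL x) (push x w) ≡ w
  push-cancelˡ x []      _ = push-inverse (sym (invL-involutive x))
  push-cancelˡ x (y ∷ w) rw with push-cases x y w
  ... | inj₂ (_ , eq)    = trans (cong (push (invL x)) eq) (push-inverse (sym (invL-involutive x)))
  ... | inj₁ (refl , eq) = trans (cong (push (invL x)) eq) (restore w rw)
    where
    -- w followed x⁻¹ in a reduced word, so pushing x⁻¹ back is a cons.
    restore : ∀ w → Reduced (invL x ∷ w) → push (invL x) w ≡ invL x ∷ w
    restore []      _          = refl
    restore (z ∷ w) (z≢x , _) = push-nonInverse z≢x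

  push-cancelʳ : ∀ x (w : Word r) → Reduced w → push x (push (invL x) w) ≡ w
  push-cancelʳ x w rw =
    subst (λ y → push y (push (invL x) w) ≡ w) (invL-involutive x) (push-cancelˡ (invL x) w rw)

  push-· : ∀ x (u w : Word r) → Reduced w → push x u · w ≡ push x (u · w)
  push-· x []      w rw = refl
  push-· x (y ∷ u) w rw with push-cases x y u
  ... | inj₁ (refl , eq) = trans (cong (_· w) eq) (sym (push-cancelʳ x (u · w) (·-reduced u w rw)))
  ... | inj₂ (_ , eq)    = cong (_· w) eq

  ·-assoc : ∀ (u v w : Word r) → Reduced w → (u · v) · w ≡ u · (v · w)
  ·-assoc []      v w rw = refl
  ·-assoc (x ∷ u) v w rw = trans (push-· x (u · v) w rw) (cong (push x) (·-assoc u v w rw))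

  ·-identityʳ : ∀ (w : Word r) → Reduced w → w · e ≡ w
  ·-identityʳ []          _           = refl
  ·-identityʳ (x ∷ [])    _           = refl
  ·-identityʳ (x ∷ y ∷ w) (y≢x⁻¹ , rw) =
    trans (cong (push x) (·-identityʳ (y ∷ w) rw)) (push-nonInverse y≢x⁻¹)

  inv-∷-· : ∀ x (v h : Word r) → inv (x ∷ v) · h ≡ inv v · push (invL x) h
  inv-∷-· x v h = begin
    inv (x ∷ v) · h          ≡⟨ cong (_· h) (unfold-reverse (invL x) (map invL v)) ⟩
    (inv v ∷ʳ invL x) · h    ≡⟨ foldr-++ push h (inv v) [ invL x ] ⟩
    inv v · push (invL x) h  ∎

  inv-cancelˡ : ∀ (v g : Word r) → Reduced g → inv v · (v · g) ≡ g
  inv-cancelˡ []      g rg = refl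
  inv-cancelˡ (x ∷ v) g rg = begin
    inv (x ∷ v) · push x (v · g)          ≡⟨ inv-∷-· x v (push x (v · g)) ⟩
    inv v · push (invL x) (push x (v · g)) ≡⟨ cong (inv v ·_) (push-cancelˡ x (v · g) (·-reduced v g rg)) ⟩
    inv v · (v · g)                        ≡⟨ inv-cancelˡ v g rg ⟩
    g                                      ∎

  inv-cancelʳ : ∀ (v g : Word r) → Reduced g → v · (inv v · g) ≡ g
  inv-cancelʳ []      g rg = refl
  inv-cancelʳ (x ∷ v) g rg = begin
    push x (v · (inv (x ∷ v) · g))         ≡⟨ cong (λ h → push x (v · h)) (inv-∷-· x v g) ⟩
    push x (v · (inv v · push (invL x) g)) ≡⟨ cong (push x) (inv-cancelʳ v _ (push-reduced (invL x) g rg)) ⟩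
    push x (push (invL x) g)               ≡⟨ push-cancelʳ x g rg ⟩
    g                                      ∎

  ·-inv-cancelʳ : ∀ (g s : Word r) → Reduced g → Reduced (inv s) → (g · s) · inv s ≡ g
  ·-inv-cancelʳ g s rg rs⁻¹ = begin
    (g · s) · inv s        ≡⟨ ·-assoc g s (inv s) rs⁻¹ ⟩
    g · (s · inv s)        ≡⟨ cong (λ t → g · (s · t)) (sym (·-identityʳ (inv s) rs⁻¹)) ⟩
    g · (s · (inv s · e))  ≡⟨ cong (g ·_) (inv-cancelʳ s e tt) ⟩
    g · e                  ≡⟨ ·-identityʳ g rg ⟩
    g                      ∎

  ·-fixes⇒identity : ∀ (v x : Word r) → Reduced v → Reduced x → v · x ≡ v → x ≡ e
  ·-fixes⇒identity v x rv rx vx≡v = begin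
    x                ≡⟨ sym (inv-cancelˡ v x rx) ⟩
    inv v · (v · x)  ≡⟨ cong (inv v ·_) (trans vx≡v (sym (·-identityʳ v rv))) ⟩
    inv v · (v · e)  ≡⟨ inv-cancelˡ v e tt ⟩
    e                ∎

  ∷ʳ-·-inverse : ∀ (xs : Word r) y → Reduced xs → (xs ∷ʳ y) · [ invL y ] ≡ xs
  ∷ʳ-·-inverse xs y rxs = begin
    (xs ∷ʳ y) · [ invL y ]  ≡⟨ foldr-++ push [ invL y ] xs [ y ] ⟩
    xs · push y [ invL y ]  ≡⟨ cong (xs ·_) (push-inverse refl) ⟩
    xs · e                  ≡⟨ ·-identityʳ xs rxs ⟩
    xs                      ∎

  reduced-++ˡ : ∀ (xs ys : Word r) → Reduced (xs ++ ys) → Reduced xs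
  reduced-++ˡ []          ys _            = tt
  reduced-++ˡ (x ∷ [])    ys _            = tt
  reduced-++ˡ (x ∷ y ∷ xs) ys (y≢x⁻¹ , rw) = y≢x⁻¹ , reduced-++ˡ (y ∷ xs) ys rw

letters-generate : ∀ {r} (S : List (Word r)) → (∀ l → [ l ] ∈ S) → Generates S
letters-generate S letter∈S g rg = map [_] g , letters∈S g , sym (trans (prod-letters g) (·-identityʳ g rg))
  where
  letters∈S : ∀ g → All (_∈ S) (map [_] g)
  letters∈S []      = All.[]
  letters∈S (x ∷ g) = letter∈S x All.∷ letters∈S g

  prod-letters : ∀ g → prod (map [_] g) ≡ g · e
  prod-letters []      = refl
  prod-letters (x ∷ g) = cong (push x) (prod-letters g)

-- Walks in a graph

module _ {V : Set} {Adj : V → V → Set} {P : V → Set} where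

  walk-start : ∀ {x y} → Walk Adj P x y → P x
  walk-start (stop px)     = px
  walk-start (step px _ _) = px

  _++ʷ_ : ∀ {x y z} → Walk Adj P x y → Walk Adj P y z → Walk Adj P x z
  stop _         ++ʷ w = w
  step px a w₁   ++ʷ w = step px a (w₁ ++ʷ w)

  reverseʷ : (∀ {x y} → P x → P y → Adj x y → Adj y x) → ∀ {x y} → Walk Adj P x y → Walk Adj P y x
  reverseʷ adj-sym (stop px)     = stop px
  reverseʷ adj-sym (step px a w) = reverseʷ adj-sym w ++ʷ step (walk-start w) (adj-sym px (walk-start w) a) (stop px)

mapʷ : ∀ {V W : Set} {A : V → V → Set} {B : W → W → Set} {P : V → Set} {Q : W → Set}
  (f : V → W) → (∀ {x} → P x → Q (f x)) → (∀ {x y} → P x → P y → A x y → B (f x) (f y)) →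
  ∀ {x y} → Walk A P x y → Walk B Q (f x) (f y)
mapʷ f pq ab (stop px)     = stop (pq px)
mapʷ f pq ab (step px a w) = step (pq px) (ab px (walk-start w) a) (mapʷ f pq ab w)

-- Cayley graphs of F_r for a symmetric set S of reduced words

module Cayley {r : ℕ} (S : List (Word r)) (S-reduced : All Reduced S) (S-symmetric : Symmetric S) where

  Γ : Word r → Word r → Set
  Γ = CayleyAdj S

  Avoiding : Word r → Word r → Set
  Avoiding v x = Reduced x × x ≢ v

  -- Γ is undirected: an s-edge is traversed backwards by s⁻¹ ∈ S.
  Γ-sym : ∀ {g h} → Reduced g → Reduced h → Γ g h → Γ h g
  Γ-sym {g} rg _ (s , s∈S , refl) =
    inv s , S-symmetric s∈S , sym (·-inv-cancelʳ g s rg (All.lookup S-reduced (S-symmetric s∈S)))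

  translate : ∀ v → Reduced v → ∀ {a b} → Walk Γ (Avoiding e) a b → Walk Γ (Avoiding v) (v · a) (v · b)
  translate v rv = mapʷ (v ·_) avoid edge
    where
    avoid : ∀ {x} → Avoiding e x → Avoiding v (v · x)
    avoid {x} (rx , x≢e) = ·-reduced v x rx , λ vx≡v → x≢e (·-fixes⇒identity v x rv rx vx≡v)

    edge : ∀ {x y} → Avoiding e x → Avoiding e y → Γ x y → Γ (v · x) (v · y)
    edge {x} _ _ (s , s∈S , refl) = s , s∈S , sym (·-assoc v x s (All.lookup S-reduced s∈S))

  -- 2-connectedness from: all letters lie in S, and every one-letter
  -- word is joined to a fixed one-letter word [ base ] inside Γ - e.
  module _ (letter∈S : ∀ l → [ l ] ∈ S) (base : Letter r)
           (letter-walk : ∀ l → Walk Γ (Avoiding e) [ l ] [ base ]) where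

    -- Strip letters from the right, never passing through e.
    walk-to-base : ∀ {x} → Reverse x → Reduced x → x ≢ e → Walk Γ (Avoiding e) x [ base ]
    walk-to-base Reverse.[] _ x≢e = ⊥-elim (x≢e refl)
    walk-to-base (.[] ∶ Reverse.[] ∶ʳ y) _ _ = letter-walk y
    walk-to-base (.(xs ∷ʳ z) ∶ (xs ∶ rs ∶ʳ z) ∶ʳ y) rx x≢e =
      step (rx , x≢e) ([ invL y ] , letter∈S (invL y) , sym (∷ʳ-·-inverse (xs ∷ʳ z) y r-prefix))
           (walk-to-base (xs ∶ rs ∶ʳ z) r-prefix (∷ʳ≢e xs))
      where
      r-prefix = reduced-++ˡ (xs ∷ʳ z) [ y ] rx
      ∷ʳ≢e : ∀ xs → xs ∷ʳ z ≢ e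
      ∷ʳ≢e []      ()
      ∷ʳ≢e (_ ∷ _) ()

    Γ-e-connected : ∀ x y → Avoiding e x → Avoiding e y → Walk Γ (Avoiding e) x y
    Γ-e-connected x y (rx , x≢e) (ry , y≢e) =
      walk-to-base (reverseView x) rx x≢e
        ++ʷ reverseʷ (λ px py → Γ-sym (proj₁ px) (proj₁ py)) (walk-to-base (reverseView y) ry y≢e)

    Γ-v-connected : ∀ v → Reduced v → ∀ x y → Avoiding v x → Avoiding v y → Walk Γ (Avoiding v) x y
    Γ-v-connected v rv x y px py =
      subst₂ (Walk Γ (Avoiding v)) (inv-cancelʳ v x (proj₁ px)) (inv-cancelʳ v y (proj₁ py))
        (translate v rv (Γ-e-connected (inv v · x) (inv v · y) (untranslate px) (untranslate py)))
      where
      untranslate : ∀ {x} → Avoiding v x → Avoiding e (inv v · x)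
      untranslate {x} (rx , x≢v) = ·-reduced (inv v) x rx , λ v⁻¹x≡e → x≢v (begin
        x                ≡⟨ sym (inv-cancelʳ v x rx) ⟩
        v · (inv v · x)  ≡⟨ cong (v ·_) v⁻¹x≡e ⟩
        v · e            ≡⟨ ·-identityʳ v rv ⟩
        v                ∎)

    walk-to-e : ∀ x → Reduced x → Walk Γ Reduced x e
    walk-to-e []      _  = stop tt
    walk-to-e (x ∷ w) rx =
      mapʷ (λ g → g) proj₁ (λ _ _ a → a) (walk-to-base (reverseView (x ∷ w)) rx λ ())
        ++ʷ step tt ([ invL base ] , letter∈S (invL base) , sym (∷ʳ-·-inverse [] base tt)) (stop tt)

    Γ-connected : ∀ x y → Reduced x → Reduced y → Walk Γ Reduced x y
    Γ-connected x y rx ry = walk-to-e x rx ++ʷ reverseʷ Γ-sym (walk-to-e y ry)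

    Γ-two-connected : CayleyTwoConnected S
    Γ-two-connected =
      ([] , [ base ] , [ invL base ] , tt , tt , tt , (λ ()) , (λ ()) ,
         λ eq → letter≢invL base (∷-injectiveˡ eq)) ,
      (([] , tt) , λ x y → Γ-connected x y) ,
      λ v rv → other-vertex v , Γ-v-connected v rv
      where
      other-vertex : ∀ v → ∃[ x ] Avoiding v x
      other-vertex []      = [ base ] , tt , λ ()
      other-vertex (_ ∷ _) = [] , tt , λ ()

map-disjoint : ∀ {A B C : Set} {f : A → C} {g : B → C} (xs : List A) (ys : List B) →
  (∀ a b → f a ≢ g b) → Disjoint (map f xs) (map g ys)
map-disjoint {f = f} {g} xs ys f≢g (v∈fxs , v∈gys) with ∈-map⁻ f v∈fxs | ∈-map⁻ g v∈gys
... | a , _ , v≡fa | b , _ , v≡gb = f≢g a b (trans (sym v≡fa) v≡gb)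

++-disjoint : ∀ {A : Set} {xs ys zs : List A} → Disjoint xs ys → Disjoint xs zs → Disjoint xs (ys ++ zs)
++-disjoint {ys = ys} xs#ys xs#zs (v∈xs , v∈ys++zs) with ∈-++⁻ ys v∈ys++zs
... | inj₁ v∈ys = xs#ys (v∈xs , v∈ys)
... | inj₂ v∈zs = xs#zs (v∈xs , v∈zs)

allFin-unique : ∀ n → Unique (allFin n)
allFin-unique n = Unique.tabulate⁺ (λ eq → eq)

length-map-allFin : ∀ {A : Set} (m : ℕ) (f : Fin m → A) → length (map f (allFin m)) ≡ m
length-map-allFin m f = trans (length-map f (allFin m)) (length-tabulate {n = m} (λ i → i))

-- The generating set of size 6r - 2, for r = n + 1

module Construction (n : ℕ) where

  r : ℕ
  r = suc n

  a⁺ a⁻ : Fin r → Letter r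
  a⁺ i = i , false
  a⁻ i = i , true

  a₀ : Letter r
  a₀ = a⁺ Fin.zero

  letters : List (Letter r)
  letters = map a⁺ (allFin r) ++ map a⁻ (allFin r)

  letter square : Letter r → Word r
  letter l = [ l ]
  square l = l ∷ l ∷ []

  -- to₀ i = a_{i+1}⁻¹ a₀ and from₀ i = a₀⁻¹ a_{i+1} = (to₀ i)⁻¹.
  to₀ from₀ : Fin n → Word r
  to₀   i = a⁻ (Fin.suc i) ∷ a₀ ∷ []
  from₀ i = a⁻ Fin.zero ∷ a⁺ (Fin.suc i) ∷ []

  mixed : List (Word r)
  mixed = map from₀ (allFin n) ++ map to₀ (allFin n)

  S : List (Word r)
  S = map letter letters ++ (map square letters ++ mixed)

  l∈letters : ∀ l → l ∈ letters
  l∈letters (i , false) = ∈-++⁺ˡ (∈-map⁺ a⁺ (∈-allFin i))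
  l∈letters (i , true)  = ∈-++⁺ʳ (map a⁺ (allFin r)) (∈-map⁺ a⁻ (∈-allFin i))

  letter∈S : ∀ l → letter l ∈ S
  letter∈S l = ∈-++⁺ˡ (∈-map⁺ letter (l∈letters l))

  square∈S : ∀ l → square l ∈ S
  square∈S l = ∈-++⁺ʳ (map letter letters) (∈-++⁺ˡ (∈-map⁺ square (l∈letters l)))

  from₀∈S : ∀ i → from₀ i ∈ S
  from₀∈S i = ∈-++⁺ʳ (map letter letters) (∈-++⁺ʳ (map square letters) (∈-++⁺ˡ (∈-map⁺ from₀ (∈-allFin i))))

  to₀∈S : ∀ i → to₀ i ∈ S
  to₀∈S i = ∈-++⁺ʳ (map letter letters)
              (∈-++⁺ʳ (map square letters) (∈-++⁺ʳ (map from₀ (allFin n)) (∈-map⁺ to₀ (∈-allFin i))))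

  data Shape : Word r → Set where
    is-letter : ∀ l → Shape (letter l)
    is-square : ∀ l → Shape (square l)
    is-from₀  : ∀ i → Shape (from₀ i)
    is-to₀    : ∀ i → Shape (to₀ i)

  shape : ∀ {s} → s ∈ S → Shape s
  shape s∈S with ∈-++⁻ (map letter letters) s∈S
  ... | inj₁ s∈ with ∈-map⁻ letter s∈
  ...   | l , _ , refl = is-letter l
  shape s∈S | inj₂ s∈ with ∈-++⁻ (map square letters) s∈
  ... | inj₁ s∈′ with ∈-map⁻ square s∈′
  ...   | l , _ , refl = is-square l
  shape s∈S | inj₂ _ | inj₂ s∈′ with ∈-++⁻ (map from₀ (allFin n)) s∈′
  ... | inj₁ s∈″ with ∈-map⁻ from₀ s∈″
  ...   | i , _ , refl = is-from₀ i
  shape s∈S | inj₂ _ | inj₂ _ | inj₂ s∈″ with ∈-map⁻ to₀ s∈″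
  ... | i , _ , refl = is-to₀ i

  S-reduced : All Reduced S
  S-reduced = All.tabulate (λ s∈S → reduced (shape s∈S))
    where
    reduced : ∀ {s} → Shape s → Reduced s
    reduced (is-letter l)           = tt
    reduced (is-square (i , false)) = (λ ()) , tt
    reduced (is-square (i , true))  = (λ ()) , tt
    reduced (is-from₀ i)            = (λ ()) , tt
    reduced (is-to₀ i)              = (λ ()) , tt

  S-symmetric : Symmetric S
  S-symmetric s∈S with shape s∈S
  ... | is-letter l = letter∈S (invL l)
  ... | is-square l = square∈S (invL l)
  ... | is-from₀ i  = to₀∈S i
  ... | is-to₀ i    = from₀∈S i

  letters-unique : Unique letters
  letters-unique =
    Unique.++⁺ (Unique.map⁺ (λ { refl → refl }) (allFin-unique r))
               (Unique.map⁺ (λ { refl → refl }) (allFin-unique r))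
               (map-disjoint (allFin r) (allFin r) λ _ _ ())

  mixed-unique : Unique mixed
  mixed-unique =
    Unique.++⁺ (Unique.map⁺ (λ { refl → refl }) (allFin-unique n))
               (Unique.map⁺ (λ { refl → refl }) (allFin-unique n))
               (map-disjoint (allFin n) (allFin n) λ _ _ ())

  -- Different shapes have different lengths or letters, so S has no repeats.
  S-unique : Unique S
  S-unique =
    Unique.++⁺ (Unique.map⁺ (λ { refl → refl }) letters-unique)
      (Unique.++⁺ (Unique.map⁺ (λ { refl → refl }) letters-unique) mixed-unique
         (++-disjoint (map-disjoint letters (allFin n) λ _ _ ()) (map-disjoint letters (allFin n) λ _ _ ())))
      (++-disjoint (map-disjoint letters letters λ _ _ ())
         (++-disjoint (map-disjoint letters (allFin n) λ _ _ ()) (map-disjoint letters (allFin n) λ _ _ ())))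

  length-letters : length letters ≡ r + r
  length-letters = trans (length-++ (map a⁺ (allFin r))) (cong₂ _+_ (length-map-allFin r a⁺) (length-map-allFin r a⁻))

  length-S : length S ≡ (r + r) + ((r + r) + (n + n))
  length-S = begin
    length S
      ≡⟨ length-++ (map letter letters) ⟩
    length (map letter letters) + length (map square letters ++ mixed)
      ≡⟨ cong (length (map letter letters) +_) (length-++ (map square letters)) ⟩
    length (map letter letters) + (length (map square letters) + length mixed)
      ≡⟨ cong₂ _+_ (trans (length-map letter letters) length-letters)
                   (cong₂ _+_ (trans (length-map square letters) length-letters) length-mixed) ⟩
    (r + r) + ((r + r) + (n + n)) ∎
    where
    length-mixed : length mixed ≡ n + n
    length-mixed = trans (length-++ (map from₀ (allFin n))) (cong₂ _+_ (length-map-allFin n from₀) (length-map-allFin n to₀))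

  S-size : 2 + length S ≡ 6 * r
  S-size = trans (cong (2 +_) length-S)
    (solve 1 (λ m → con 2 :+ (((con 1 :+ m) :+ (con 1 :+ m)) :+ (((con 1 :+ m) :+ (con 1 :+ m)) :+ (m :+ m)))
                   := con 6 :* (con 1 :+ m)) refl n)
    where open +-*-Solver

  S-small : length S < 6 * r
  S-small = subst (length S <_) S-size (m≤n⇒m≤1+n (n<1+n (length S)))

  open Cayley S S-reduced S-symmetric

  -- a_{i+1} —(a_{i+1}⁻¹a₀)— a₀, avoiding e.
  positive-walk : ∀ i → Walk Γ (Avoiding e) [ a⁺ i ] [ a₀ ]
  positive-walk Fin.zero    = stop (tt , λ ())
  positive-walk (Fin.suc i) = step (tt , λ ()) (to₀ i , to₀∈S i , sym a⁺·to₀≡a₀) (stop (tt , λ ()))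
    where
    a⁺·to₀≡a₀ : [ a⁺ (Fin.suc i) ] · to₀ i ≡ [ a₀ ]
    a⁺·to₀≡a₀ = trans (cong (push (a⁺ (Fin.suc i))) (push-nonInverse {x = a⁻ (Fin.suc i)} {w = []} λ ()))
                      (push-inverse {x = a⁺ (Fin.suc i)} refl)

  -- a_i⁻¹ —(a_i²)— a_i, avoiding e.
  letter-walk : ∀ l → Walk Γ (Avoiding e) [ l ] [ a₀ ]
  letter-walk (i , false) = positive-walk i
  letter-walk (i , true)  =
    step (tt , λ ()) (square (a⁺ i) , square∈S (a⁺ i) , sym (push-inverse refl)) (positive-walk i)

  theorem : ∃[ S ] (IsSubset {r} S × Symmetric S × Generates S × length S < 6 * r × CayleyTwoConnected S)
  theorem = S , (S-reduced , S-unique) , S-symmetric , letters-generate S letter∈S , S-small ,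
            Γ-two-connected letter∈S a₀ letter-walk

mainTheorem16 : ∀ (r : ℕ) → 1 ≤ r →
    ∃[ S ] (IsSubset {r} S × Symmetric S × Generates S
    × length S < 6 * r × CayleyTwoConnected S)
mainTheorem16 (suc n) _ = Construction.theorem n
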